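{- Let $I'_{sat}$ be a CNF formula on $3n$ variables $z_1,\dots,z_{3n}$ whose clauses are divided into sets $C_1$ and $C_2$, where every variable appears exactly once (as a single literal, positive or negative) in the clauses of $C_1$, each clause of $C_1$ contains two or three literals, and $C_2$ consists exactly of the clauses $(z_{3i+1}\vee\neg z_{3i+2})$, $(z_{3i+2}\vee\neg z_{3i+3})$, $(z_{3i+3}\vee\neg z_{3i+1})$ for $i=0,1,\dots,n-1$. Construct the instance $I_{3dm}$ as follows. Elements: $w_i$ and $\bar w_i$ for each $1\le i\le 3n$; an element $s_j$ for each clause $c_j\in C_1$; and $a_{3i+1},a_{3i+2},a_{3i+3},b_{3i+1},b_{3i+2},b_{3i+3}$ for each $0\le i\le n-1$. Matches: the one-element matches $(w_i)$ and $(\bar w_i)$ for each $i$; for each clause $c_j\in C_1$ and each literal in it, the match $(w_i,s_j)$ if the positive literal $z_i\in c_j$ and $(\bar w_i,s_j)$ if the negative literal $\neg z_i\in c_j$; and, for each $0\le i\le n-1$, the six matches $(w_{3i+1},a_{3i+1},b_{3i+1})$, $(w_{3i+2},a_{3i+2},b_{3i+2})$, $(w_{3i+3},a_{3i+3},b_{3i+3})$, $(\bar w_{3i+1},a_{3i+1},b_{3i+2})$, $(\bar w_{3i+2},a_{3i+2},b_{3i+3})$, $(\bar w_{3i+3},a_{3i+3},b_{3i+1})$. Then $I'_{sat}$ is satisfiable if and only if $I_{3dm}$ admits an exact cover, i.e., a subset of the matches in which every element appears exactly once. -}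

module Defs where

open import Data.Nat using (ℕ; _*_)
open import Data.Bool using (Bool; true; false)
open import Data.Fin using (Fin; zero; suc; combine)
import Data.Fin.Properties as FinP
open import Data.List using (List; []; _∷_; _++_; map; concat; concatMap; allFin; length; lookup; filter)
open import Data.List.Relation.Unary.All using (All)
open import Data.List.Relation.Unary.Any using (Any)
open import Data.List.Relation.Binary.Sublist.Propositional using (_⊆_)
open import Data.Product using (Σ; ∃; _,_; _×_)
open import Data.Sum using (_⊎_)
open import Relation.Binary.PropositionalEquality using (_≡_; refl; cong)
open import Relation.Nullary using (Dec; yes; no)
open import Relation.Nullary.Decidable using (map′)

-- CNF formulas on the 3n variables z_1 … z_{3n}.
-- Variable z_{3i+r+1} (0 ≤ i < n, 0 ≤ r < 3) is represented by
-- combine i r : Fin (n * 3), whose value is 3i + r (0-based index).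

Var : ℕ → Set
Var n = Fin (n * 3)

z : ∀ {n} → Fin n → Fin 3 → Var n
z i r = combine i r

-- A literal: a variable together with its sign (true = positive z, false = ¬ z).
record Literal (n : ℕ) : Set where
  constructor lit
  field
    var  : Var n
    sign : Bool
open Literal public

Clause : ℕ → Set
Clause n = List (Literal n)

CNF : ℕ → Set
CNF n = List (Clause n)

Satisfies : ∀ {n} → (Var n → Bool) → CNF n → Set
Satisfies σ φ = All (λ c → Any (λ l → σ (var l) ≡ sign l) c) φ

Satisfiable : ∀ {n} → CNF n → Set
Satisfiable {n} φ = ∃ λ (σ : Var n → Bool) → Satisfies σ φ

next : Fin 3 → Fin 3
next zero = suc zero
next (suc zero) = suc (suc zero)
next (suc (suc zero)) = zero

C2 : (n : ℕ) → CNF n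
C2 n = concatMap (λ i → map (λ r → lit (z i r) true ∷ lit (z i (next r)) false ∷ [])
                             (allFin 3))
                 (allFin n)

WellFormedC1 : ∀ {n} → CNF n → Set
WellFormedC1 {n} C1 =
  (∀ (v : Var n) → length (filter (λ l → var l FinP.≟ v) (concat C1)) ≡ 1)
  × All (λ c → length c ≡ 2 ⊎ length c ≡ 3) C1

data Element (n m : ℕ) : Set where
  w w̄ a b : Var n → Element n m
  s       : Fin m → Element n m

infix 4 _≟ₑ_
_≟ₑ_ : ∀ {n m} → (x y : Element n m) → Dec (x ≡ y)
w x ≟ₑ w y = map′ (cong w) (λ { refl → refl }) (x FinP.≟ y)
w̄ x ≟ₑ w̄ y = map′ (cong w̄) (λ { refl → refl }) (x FinP.≟ y)
a x ≟ₑ a y = map′ (cong a) (λ { refl → refl }) (x FinP.≟ y)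
b x ≟ₑ b y = map′ (cong b) (λ { refl → refl }) (x FinP.≟ y)
s x ≟ₑ s y = map′ (cong s) (λ { refl → refl }) (x FinP.≟ y)
w _ ≟ₑ w̄ _ = no λ ()
w _ ≟ₑ a _ = no λ ()
w _ ≟ₑ b _ = no λ ()
w _ ≟ₑ s _ = no λ ()
w̄ _ ≟ₑ w _ = no λ ()
w̄ _ ≟ₑ a _ = no λ ()
w̄ _ ≟ₑ b _ = no λ ()
w̄ _ ≟ₑ s _ = no λ ()
a _ ≟ₑ w _ = no λ ()
a _ ≟ₑ w̄ _ = no λ ()
a _ ≟ₑ b _ = no λ ()
a _ ≟ₑ s _ = no λ ()
b _ ≟ₑ w _ = no λ ()
b _ ≟ₑ w̄ _ = no λ ()
b _ ≟ₑ a _ = no λ ()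
b _ ≟ₑ s _ = no λ ()
s _ ≟ₑ w _ = no λ ()
s _ ≟ₑ w̄ _ = no λ ()
s _ ≟ₑ a _ = no λ ()
s _ ≟ₑ b _ = no λ ()

Match : ℕ → ℕ → Set
Match n m = List (Element n m)

wLit : ∀ {n m} → Literal n → Element n m
wLit (lit v true)  = w v
wLit (lit v false) = w̄ v

matches : ∀ {n} → (C1 : CNF n) → List (Match n (length C1))
matches {n} C1 =
     map (λ v → w v ∷ []) (allFin (n * 3))
  ++ map (λ v → w̄ v ∷ []) (allFin (n * 3))
  ++ concatMap (λ j → map (λ l → wLit l ∷ s j ∷ []) (lookup C1 j))
               (allFin (length C1))
  ++ concatMap (λ i → map (λ r → w (z i r) ∷ a (z i r) ∷ b (z i r) ∷ [])
                           (allFin 3)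
                   ++ map (λ r → w̄ (z i r) ∷ a (z i r) ∷ b (z i (next r)) ∷ [])
                           (allFin 3))
               (allFin n)

ExactCover : ∀ {n m} → List (Match n m) → Set
ExactCover {n} {m} M =
  Σ (List (Match n m)) λ S → (S ⊆ M) ×
    (∀ (e : Element n m) → length (filter (λ x → x ≟ₑ e) (concat S)) ≡ 1)

-- The C2 clauses chain the three variables of a triple into a cycle of
-- implications, so σ is constant on each triple. Gadget i is covered by its three (w̄, a, b)
-- matches when its triple is true and by its three (w, a, b) matches otherwise: every a and b
-- is covered once, and w_v (resp. w̄_v) is left free exactly when z_v is true (resp. false).
-- Each clause c_j takes the match (w_v, s_j) or (w̄_v, s_j) of one of its true literals; these
-- use only free elements, each at most once since every variable occurs once in C1. The
-- remaining w's and w̄'s take their one-element matches.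
--
-- Make z_{3i+r+1} true iff the match (w̄, a, b) of gadget i at position r
-- is in the cover; otherwise covering a_{3i+r+1} forces the match (w, a, b) at that position.
-- Covering b then makes truth at position next r propagate to position r, which is the C2
-- clause. The match covering s_j is (w_v, s_j) or (w̄_v, s_j) for a literal of c_j, and the
-- gadget match chosen at v cannot cover the same element, so that literal is true.

module Submission where

open import Defs
open import Data.Bool using (Bool; true; false; not)
import Data.Bool as Bool
open import Data.Bool.Properties using (not-¬)
open import Data.Empty using (⊥; ⊥-elim)
open import Data.Fin using (Fin; zero; suc; punchIn; remQuot)
open import Data.Fin.Patterns using (0F; 1F; 2F)
import Data.Fin.Properties as FinP
open import Data.List using (List; []; _∷_; _++_; map; concat; concatMap; allFin; tabulate; filter; length; lookup)
import Data.List.Properties as ListP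
open import Data.List.Membership.Propositional using (_∈_; _∉_; lose; find)
open import Data.List.Membership.Propositional.Properties
  using (∈-filter⁺; ∈-concat⁺′; ∈-concat⁻′; ∈-map⁺; ∈-allFin; ∈-lookup)
open import Data.List.Relation.Unary.All as All using (All; []; _∷_; universal)
import Data.List.Relation.Unary.All.Properties as Allₚ
open import Data.List.Relation.Unary.Any using (Any; here; there)
open import Data.List.Relation.Binary.Sublist.Propositional as Sublist using (_⊆_; []; _∷_; _∷ʳ_)
import Data.List.Relation.Binary.Sublist.Propositional.Properties as Sublistₚ
open import Data.Nat using (ℕ; zero; suc; _+_; _*_; _≤_; z≤n; s≤s)
open import Data.Nat.Properties
  using (module ≤-Reasoning; +-0-commutativeMonoid; +-identityʳ; +-comm; +-assoc; +-mono-≤; ≤-reflexive; ≤-trans; m≤n+m)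
open import Data.Product using (∃; _×_; _,_; proj₁; proj₂; uncurry)
open import Data.Sum using (_⊎_; inj₁; inj₂)
open import Function using (_∘_)
open import Function.Definitions using (Injective)
open import Function.Bundles using (_⇔_; mk⇔)
open import Relation.Binary.Definitions using (DecidableEquality)
open import Relation.Binary.PropositionalEquality
  using (_≡_; _≢_; refl; sym; trans; cong; cong₂; subst; module ≡-Reasoning)
open import Relation.Nullary using (Dec; yes; no; does)
open import Relation.Nullary.Decidable using (dec-true)
open import Relation.Unary using (Pred; Decidable)

open import Algebra.Properties.CommutativeMonoid.Sum +-0-commutativeMonoid
  using (sum; sum-syntax; sum-cong-≗; sum-replicate-zero; sum-remove)

∑-zero : ∀ {k} (f : Fin k → ℕ) → (∀ i → f i ≡ 0) → ∑[ i < k ] f i ≡ 0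
∑-zero {k} f f≡0 = trans (sum-cong-≗ f≡0) (sum-replicate-zero k)

∑-single : ∀ {k} (f : Fin k → ℕ) j → (∀ i → i ≢ j → f i ≡ 0) → ∑[ i < k ] f i ≡ f j
∑-single {suc k} f j f≡0 = begin
  sum f                      ≡⟨ sum-remove {i = j} f ⟩
  f j + sum (f ∘ punchIn j)  ≡⟨ cong (f j +_) (∑-zero _ λ i → f≡0 _ (FinP.punchInᵢ≢i j i)) ⟩
  f j + 0                    ≡⟨ +-identityʳ (f j) ⟩
  f j                        ∎
  where open ≡-Reasoning

∑-mono-≤ : ∀ {k} (f g : Fin k → ℕ) → (∀ i → f i ≤ g i) → ∑[ i < k ] f i ≤ ∑[ i < k ] g i
∑-mono-≤ {zero}  f g f≤g = z≤n
∑-mono-≤ {suc k} f g f≤g = +-mono-≤ (f≤g zero) (∑-mono-≤ (f ∘ suc) (g ∘ suc) (f≤g ∘ suc))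

∑-next : (f : Fin 3 → ℕ) → ∑[ r < 3 ] f (next r) ≡ ∑[ r < 3 ] f r
∑-next f = begin
  f 1F + (f 2F + (f 0F + 0))  ≡⟨ cong (λ t → f 1F + (f 2F + t)) (+-identityʳ (f 0F)) ⟩
  f 1F + (f 2F + f 0F)        ≡⟨ cong (f 1F +_) (+-comm (f 2F) (f 0F)) ⟩
  f 1F + (f 0F + f 2F)        ≡⟨ sym (+-assoc (f 1F) (f 0F) (f 2F)) ⟩
  f 1F + f 0F + f 2F          ≡⟨ cong (_+ f 2F) (+-comm (f 1F) (f 0F)) ⟩
  f 0F + f 1F + f 2F          ≡⟨ +-assoc (f 0F) (f 1F) (f 2F) ⟩
  f 0F + (f 1F + f 2F)        ≡⟨ cong (λ t → f 0F + (f 1F + t)) (sym (+-identityʳ (f 2F))) ⟩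
  f 0F + (f 1F + (f 2F + 0))  ∎
  where open ≡-Reasoning

module _ {A : Set} {ℓ} {P : Pred A ℓ} (P? : Decidable P) where

  length-filter-++ : ∀ xs ys →
    length (filter P? (xs ++ ys)) ≡ length (filter P? xs) + length (filter P? ys)
  length-filter-++ xs ys =
    trans (cong length (ListP.filter-++ P? xs ys)) (ListP.length-++ (filter P? xs))

  length-filter-concat-tabulate : ∀ {k} (f : Fin k → List A) →
    length (filter P? (concat (tabulate f))) ≡ ∑[ i < k ] length (filter P? (f i))
  length-filter-concat-tabulate {zero}  f = refl
  length-filter-concat-tabulate {suc k} f =
    trans (length-filter-++ (f zero) _) (cong (length (filter P? (f zero)) +_) (length-filter-concat-tabulate (f ∘ suc)))

  length-filter-∈ : ∀ {x xs} → x ∈ xs → P x → 1 ≤ length (filter P? xs)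
  length-filter-∈ x∈xs px = nonempty (∈-filter⁺ P? x∈xs px)
    where
    nonempty : ∀ {x ys} → x ∈ ys → 1 ≤ length ys
    nonempty {ys = _ ∷ _} _ = s≤s z≤n

concatMap-⊆-map : ∀ {A B : Set} {F : A → List B} {g : A → B} →
  (∀ x → F x ⊆ g x ∷ []) → ∀ xs → concatMap F xs ⊆ map g xs
concatMap-⊆-map F⊆g []       = []
concatMap-⊆-map F⊆g (x ∷ xs) = Sublistₚ.++⁺ (F⊆g x) (concatMap-⊆-map F⊆g xs)

map-⊆-concatMap : ∀ {A B : Set} {f : A → B} {G : A → List B} →
  (∀ x → f x ∷ [] ⊆ G x) → ∀ xs → map f xs ⊆ concatMap G xs
map-⊆-concatMap f⊆G []       = []
map-⊆-concatMap f⊆G (x ∷ xs) = Sublistₚ.++⁺ (f⊆G x) (map-⊆-concatMap f⊆G xs)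

concatMap⁺ : ∀ {A B : Set} {F G : A → List B} →
  (∀ x → F x ⊆ G x) → ∀ xs → concatMap F xs ⊆ concatMap G xs
concatMap⁺ F⊆G []       = []
concatMap⁺ F⊆G (x ∷ xs) = Sublistₚ.++⁺ (F⊆G x) (concatMap⁺ F⊆G xs)

module Occurrences {A : Set} (_≟_ : DecidableEquality A) where

  opaque
    occ : A → List A → ℕ
    occ e xs = length (filter (_≟ e) xs)

  occs : A → List (List A) → ℕ
  occs e xss = occ e (concat xss)

  opaque
    unfolding occ

    occ-filter : ∀ e xs → occ e xs ≡ length (filter (_≟ e) xs)
    occ-filter e xs = refl

    occ-[] : ∀ e → occ e [] ≡ 0
    occ-[] e = refl

    occ-++ : ∀ e xs ys → occ e (xs ++ ys) ≡ occ e xs + occ e ys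
    occ-++ e = length-filter-++ (_≟ e)

    occ-concat-tabulate : ∀ e {k} (f : Fin k → List A) → occ e (concat (tabulate f)) ≡ ∑[ i < k ] occ e (f i)
    occ-concat-tabulate e = length-filter-concat-tabulate (_≟ e)

    occ-self : ∀ e → occ e (e ∷ []) ≡ 1
    occ-self e = cong length (ListP.filter-accept (_≟ e) refl)

    occ-≢ : ∀ {e x} → x ≢ e → occ e (x ∷ []) ≡ 0
    occ-≢ x≢e = cong length (ListP.filter-reject (_≟ _) x≢e)

    occ-∈ : ∀ {e xs} → e ∈ xs → 1 ≤ occ e xs
    occ-∈ e∈xs = length-filter-∈ (_≟ _) e∈xs refl

    occ-suc⇒∈ : ∀ {e xs k} → occ e xs ≡ suc k → e ∈ xs
    occ-suc⇒∈ {e} {x ∷ xs} eq with x ≟ e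
    ... | yes refl = here refl
    ... | no _     = there (occ-suc⇒∈ eq)

  occ-∷ : ∀ e x xs → occ e (x ∷ xs) ≡ occ e (x ∷ []) + occ e xs
  occ-∷ e x xs = occ-++ e (x ∷ []) xs

  occ-skip : ∀ {e x xs} → x ≢ e → occ e (x ∷ xs) ≡ occ e xs
  occ-skip {e} {x} {xs} x≢e = trans (occ-∷ e x xs) (cong (_+ occ e xs) (occ-≢ x≢e))

  occ-∉ : ∀ {e xs} → e ∉ xs → occ e xs ≡ 0
  occ-∉ {e} {[]}     _  = occ-[] e
  occ-∉ {e} {x ∷ xs} e∉ = trans (occ-∷ e x xs) (cong₂ _+_ (occ-≢ (e∉ ∘ here ∘ sym)) (occ-∉ (e∉ ∘ there)))

  occ-∷-∉ : ∀ {e x xs} → e ∉ xs → occ e (x ∷ xs) ≡ occ e (x ∷ [])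
  occ-∷-∉ {e} {x} {xs} e∉xs = trans (occ-∷ e x xs) (trans (cong (occ e (x ∷ []) +_) (occ-∉ e∉xs)) (+-identityʳ _))

  occ-[]-≤ : ∀ {e x t} → (x ≡ e → 1 ≤ t) → occ e (x ∷ []) ≤ t
  occ-[]-≤ {e} {x} {t} bound with x ≟ e
  ... | yes refl = subst (_≤ t) (sym (occ-self e)) (bound refl)
  ... | no  x≢e  = subst (_≤ t) (sym (occ-≢ x≢e)) z≤n

  occs-∷ : ∀ e x xss → occs e (x ∷ xss) ≡ occ e x + occs e xss
  occs-∷ e x xss = occ-++ e x (concat xss)

  occs-++ : ∀ e xss yss → occs e (xss ++ yss) ≡ occs e xss + occs e yss
  occs-++ e xss yss = trans (cong (occ e) (sym (ListP.concat-++ xss yss))) (occ-++ e (concat xss) _)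

  occs-map-allFin : ∀ e {k} (f : Fin k → List A) → occs e (map f (allFin k)) ≡ ∑[ i < k ] occ e (f i)
  occs-map-allFin e f = trans (cong (occ e ∘ concat) (ListP.map-tabulate (λ i → i) f)) (occ-concat-tabulate e f)

  occs-concatMap-allFin : ∀ e {k} (F : Fin k → List (List A)) →
    occs e (concatMap F (allFin k)) ≡ ∑[ i < k ] occs e (F i)
  occs-concatMap-allFin e F = trans (cong (occs e ∘ concat) (ListP.map-tabulate (λ i → i) F)) (occs-concat-tabulate F)
    where
    occs-concat-tabulate : ∀ {k} (F : Fin k → List (List A)) → occs e (concat (tabulate F)) ≡ ∑[ i < k ] occs e (F i)
    occs-concat-tabulate {zero}  F = occ-[] e
    occs-concat-tabulate {suc k} F =
      trans (occs-++ e (F zero) _) (cong (occs e (F zero) +_) (occs-concat-tabulate (F ∘ suc)))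

  ∑-occ-injective : ∀ {k} {κ : Fin k → A} → Injective _≡_ _≡_ κ → ∀ j → ∑[ i < k ] occ (κ j) (κ i ∷ []) ≡ 1
  ∑-occ-injective κ-inj j =
    trans (∑-single _ j (λ i i≢j → occ-≢ (i≢j ∘ κ-inj))) (occ-self _)

  ∑-occ-∉ : ∀ {k} {κ : Fin k → A} {e} → (∀ i → κ i ≢ e) → ∑[ i < k ] occ e (κ i ∷ []) ≡ 0
  ∑-occ-∉ κ≢e = ∑-zero _ (λ i → occ-≢ (κ≢e i))

  occs-∈ : ∀ {e x xss} → x ∈ xss → e ∈ x → 1 ≤ occs e xss
  occs-∈ x∈xss e∈x = occ-∈ (∈-concat⁺′ e∈x x∈xss)

  not-twice : ∀ {e x y xss} → occs e (x ∷ xss) ≤ 1 → e ∈ x → y ∈ xss → e ∈ y → ⊥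
  not-twice {e} {x} {xss = xss} ≤1 e∈x y∈xss e∈y
    with ≤-trans (+-mono-≤ (occ-∈ e∈x) (occs-∈ y∈xss e∈y)) (subst (_≤ 1) (occs-∷ e x xss) ≤1)
  ... | s≤s ()

  occs≤1-unique : ∀ {e x y xss} → occs e xss ≤ 1 → x ∈ xss → y ∈ xss → e ∈ x → e ∈ y → x ≡ y
  occs≤1-unique _  (here refl) (here refl) _ _ = refl
  occs≤1-unique ≤1 (here refl) (there y∈xss) e∈x e∈y = ⊥-elim (not-twice ≤1 e∈x y∈xss e∈y)
  occs≤1-unique ≤1 (there x∈xss) (here refl) e∈x e∈y = ⊥-elim (not-twice ≤1 e∈y x∈xss e∈x)
  occs≤1-unique {e} {xss = x ∷ xss} ≤1 (there x∈xss) (there y∈xss) =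
    occs≤1-unique (≤-trans (m≤n+m _ (occ e x)) (subst (_≤ 1) (occs-∷ e x xss) ≤1)) x∈xss y∈xss

  occs≡1-covered : ∀ {e xss} → occs e xss ≡ 1 → ∃ λ x → x ∈ xss × e ∈ x
  occs≡1-covered {xss = xss} eq with ∈-concat⁻′ xss (occ-suc⇒∈ eq)
  ... | x , e∈x , x∈xss = x , x∈xss , e∈x

  fillIfZero : ℕ → A → List (List A)
  fillIfZero zero    e = (e ∷ []) ∷ []
  fillIfZero (suc _) e = []

  padding : ∀ {k} → List (List A) → (Fin k → A) → List (List A)
  padding {k} R κ = concatMap (λ i → fillIfZero (occs (κ i) R) (κ i)) (allFin k)

  padding-⊆ : ∀ {k} R (κ : Fin k → A) → padding R κ ⊆ map (λ i → κ i ∷ []) (allFin k)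
  padding-⊆ R κ = concatMap-⊆-map (λ i → fill⊆ (occs (κ i) R) (κ i)) _
    where
    fill⊆ : ∀ t e → fillIfZero t e ⊆ (e ∷ []) ∷ []
    fill⊆ zero    e = refl ∷ []
    fill⊆ (suc t) e = _ ∷ʳ []

  occs-fillIfZero-self : ∀ e t → t ≤ 1 → occs e (fillIfZero t e) + t ≡ 1
  occs-fillIfZero-self e zero          _ = trans (+-identityʳ _) (occ-self e)
  occs-fillIfZero-self e (suc zero)    _ = cong (_+ 1) (occ-[] e)
  occs-fillIfZero-self e (suc (suc t)) (s≤s ())

  occs-fillIfZero-≢ : ∀ {e x} t → x ≢ e → occs e (fillIfZero t x) ≡ 0
  occs-fillIfZero-≢ zero    x≢e = occ-≢ x≢e
  occs-fillIfZero-≢ (suc t) x≢e = occ-[] _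

  occs-padding : ∀ {k} R (κ : Fin k → A) e →
    occs e (padding R κ) ≡ ∑[ i < k ] occs e (fillIfZero (occs (κ i) R) (κ i))
  occs-padding R κ e = occs-concatMap-allFin e (λ i → fillIfZero (occs (κ i) R) (κ i))

  occs-padding-self : ∀ {k} R (κ : Fin k → A) → Injective _≡_ _≡_ κ → ∀ j →
    occs (κ j) R ≤ 1 → occs (κ j) (padding R κ) + occs (κ j) R ≡ 1
  occs-padding-self {k} R κ κ-inj j ≤1 = begin
    occs (κ j) (padding R κ) + occs (κ j) R
      ≡⟨ cong (_+ occs (κ j) R) (occs-padding R κ (κ j)) ⟩
    ∑[ i < k ] occs (κ j) (fillIfZero (occs (κ i) R) (κ i)) + occs (κ j) R
      ≡⟨ cong (_+ occs (κ j) R) (∑-single _ j λ i i≢j → occs-fillIfZero-≢ (occs (κ i) R) (i≢j ∘ κ-inj)) ⟩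
    occs (κ j) (fillIfZero (occs (κ j) R) (κ j)) + occs (κ j) R
      ≡⟨ occs-fillIfZero-self (κ j) (occs (κ j) R) ≤1 ⟩
    1 ∎
    where open ≡-Reasoning

  occs-padding-other : ∀ {k} R (κ : Fin k → A) {e} → (∀ i → κ i ≢ e) → occs e (padding R κ) ≡ 0
  occs-padding-other R κ {e} κ≢e =
    trans (occs-padding R κ e) (∑-zero _ λ i → occs-fillIfZero-≢ (occs (κ i) R) (κ≢e i))

module _ (f : Fin 3 → Bool) (back : ∀ r → f (next r) ≡ true → f r ≡ true) where

  private
    to-zero : ∀ r → f r ≡ true → f 0F ≡ true
    to-zero 0F p = p
    to-zero 1F p = back 0F p
    to-zero 2F p = back 0F (back 1F p)

    from-zero : f 0F ≡ true → ∀ r → f r ≡ true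
    from-zero p 0F = p
    from-zero p 1F = back 1F (back 2F p)
    from-zero p 2F = back 2F p

  cycle-constant : ∀ r → f r ≡ f 0F
  cycle-constant r with f r in fr | f 0F in f0
  ... | true  | true  = refl
  ... | false | false = refl
  ... | true  | false with () ← trans (sym (to-zero r fr)) f0
  ... | false | true  with () ← trans (sym (from-zero f0 r)) fr

next-injective : ∀ {r r′} → next r ≡ next r′ → r ≡ r′
next-injective {r} {r′} eq = trans (sym (next³ r)) (trans (cong (next ∘ next) eq) (next³ r′))
  where
  next³ : ∀ r → next (next (next r)) ≡ r
  next³ 0F = refl
  next³ 1F = refl
  next³ 2F = refl

z-injective : ∀ {n} {i i′ : Fin n} {r r′} → z i r ≡ z i′ r′ → i ≡ i′ × r ≡ r′
z-injective = FinP.combine-injective _ _ _ _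

Holds : ∀ {n} → (Var n → Bool) → Literal n → Set
Holds σ l = σ (var l) ≡ sign l

tripleClause : ∀ {n} → Fin n → Fin 3 → Clause n
tripleClause i r = lit (z i r) true ∷ lit (z i (next r)) false ∷ []

tripleClause-∈-C2 : ∀ {n} (i : Fin n) r → tripleClause i r ∈ C2 n
tripleClause-∈-C2 i r =
  ∈-concat⁺′ (∈-map⁺ (tripleClause i) (∈-allFin r)) (∈-map⁺ (λ i → map (tripleClause i) (allFin 3)) (∈-allFin i))

rot : Bool → Fin 3 → Fin 3
rot false r = r
rot true  r = next r

-- The match of gadget i at position r used when z_{3i+1}, z_{3i+2}, z_{3i+3} all take the
-- value β; it covers the w-element of the literal that β falsifies.
gadgetMatch : ∀ {n m} → Bool → Fin n → Fin 3 → Match n m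
gadgetMatch β i r = wLit (lit (z i r) (not β)) ∷ a (z i r) ∷ b (z i (rot β r)) ∷ []

clauseMatch : ∀ {n m} → Fin m → Literal n → Match n m
clauseMatch j l = wLit l ∷ s j ∷ []

module _ {n m : ℕ} where

  wLit≢a : ∀ l {u} → wLit {n} {m} l ≢ a u
  wLit≢a (lit _ true)  ()
  wLit≢a (lit _ false) ()

  wLit≢b : ∀ l {u} → wLit {n} {m} l ≢ b u
  wLit≢b (lit _ true)  ()
  wLit≢b (lit _ false) ()

  wLit≢s : ∀ l {j} → wLit {n} {m} l ≢ s j
  wLit≢s (lit _ true)  ()
  wLit≢s (lit _ false) ()

  w-injective : Injective _≡_ _≡_ (w {n} {m})
  w-injective refl = refl

  w̄-injective : Injective _≡_ _≡_ (w̄ {n} {m})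
  w̄-injective refl = refl

  a-injective : Injective _≡_ _≡_ (a {n} {m})
  a-injective refl = refl

  b-injective : Injective _≡_ _≡_ (b {n} {m})
  b-injective refl = refl

  s-injective : Injective _≡_ _≡_ (s {n} {m})
  s-injective refl = refl

  wLit-injective : Injective _≡_ _≡_ (wLit {n} {m})
  wLit-injective {lit _ true}  {lit _ true}  refl = refl
  wLit-injective {lit _ false} {lit _ false} refl = refl

  clauseMatch≢gadgetMatch : ∀ {j l β i r} → clauseMatch {n} {m} j l ≢ gadgetMatch β i r
  clauseMatch≢gadgetMatch ()

module Reduction {n : ℕ} (C1 : CNF n) where

  El : Set
  El = Element n (length C1)

  open Occurrences (_≟ₑ_ {n} {length C1})

  data IsMatch : List El → Set where
    singleton-w  : ∀ v → IsMatch (w v ∷ [])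
    singleton-w̄  : ∀ v → IsMatch (w̄ v ∷ [])
    clause       : ∀ j {l} → l ∈ lookup C1 j → IsMatch (clauseMatch j l)
    gadget       : ∀ β i r → IsMatch (gadgetMatch β i r)

  all-matches : All IsMatch (matches C1)
  all-matches = Allₚ.++⁺ ws (Allₚ.++⁺ w̄s (Allₚ.++⁺ clauses gadgets))
    where
    ws : All IsMatch (map (λ v → w v ∷ []) (allFin (n * 3)))
    ws = Allₚ.map⁺ (universal singleton-w _)
    w̄s : All IsMatch (map (λ v → w̄ v ∷ []) (allFin (n * 3)))
    w̄s = Allₚ.map⁺ (universal singleton-w̄ _)
    clauses : All IsMatch (concatMap (λ j → map (clauseMatch j) (lookup C1 j)) (allFin (length C1)))
    clauses = Allₚ.concat⁺ (Allₚ.map⁺ (universal (λ j → Allₚ.map⁺ (All.tabulate (clause j))) (allFin (length C1))))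
    gadget-block : ∀ β i → All IsMatch (map (gadgetMatch β i) (allFin 3))
    gadget-block β i = Allₚ.map⁺ (universal (gadget β i) (allFin 3))
    gadgets : All IsMatch
      (concatMap (λ i → map (gadgetMatch false i) (allFin 3) ++ map (gadgetMatch true i) (allFin 3)) (allFin n))
    gadgets = Allₚ.concat⁺ (Allₚ.map⁺ (universal (λ i → Allₚ.++⁺ (gadget-block false i) (gadget-block true i)) (allFin n)))

  a-location : ∀ {x i r} → IsMatch x → a (z i r) ∈ x → ∃ λ β → x ≡ gadgetMatch β i r
  a-location (singleton-w _)   (here ())
  a-location (singleton-w _)   (there ())
  a-location (singleton-w̄ _)   (here ())
  a-location (singleton-w̄ _)   (there ())
  a-location (clause _ {l} _)  (here p)           = ⊥-elim (wLit≢a l (sym p))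
  a-location (clause _ _)      (there (here ()))
  a-location (clause _ _)      (there (there ()))
  a-location (gadget β _ _)    (here p)           = ⊥-elim (wLit≢a (lit _ (not β)) (sym p))
  a-location {i = i} {r} (gadget β i′ r′) (there (here p))
    with refl , refl ← z-injective {i = i} {i′} {r} {r′} (a-injective p) = β , refl
  a-location (gadget _ _ _)    (there (there (here ())))
  a-location (gadget _ _ _)    (there (there (there ())))

  b-location : ∀ {x i r} → IsMatch x → b (z i (next r)) ∈ x →
               x ≡ gadgetMatch false i (next r) ⊎ x ≡ gadgetMatch true i r
  b-location (singleton-w _)     (here ())
  b-location (singleton-w _)     (there ())
  b-location (singleton-w̄ _)     (here ())
  b-location (singleton-w̄ _)     (there ())
  b-location (clause _ {l} _)    (here p)           = ⊥-elim (wLit≢b l (sym p))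
  b-location (clause _ _)        (there (here ()))
  b-location (clause _ _)        (there (there ()))
  b-location (gadget β _ _)      (here p)           = ⊥-elim (wLit≢b (lit _ (not β)) (sym p))
  b-location (gadget _ _ _)      (there (here ()))
  b-location {i = i} {r} (gadget false i′ r′) (there (there (here p)))
    with refl , refl ← z-injective {i = i} {i′} {next r} {r′} (b-injective p) = inj₁ refl
  b-location {i = i} {r} (gadget true i′ r′) (there (there (here p)))
    with refl , q ← z-injective {i = i} {i′} {next r} {next r′} (b-injective p)
    with refl ← next-injective q = inj₂ refl
  b-location (gadget _ _ _)      (there (there (there ())))

  s-location : ∀ {x j} → IsMatch x → s j ∈ x → ∃ λ l → l ∈ lookup C1 j × x ≡ clauseMatch j l
  s-location (singleton-w _)     (here ())
  s-location (singleton-w _)     (there ())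
  s-location (singleton-w̄ _)     (here ())
  s-location (singleton-w̄ _)     (there ())
  s-location (clause _ {l} _)    (here p)           = ⊥-elim (wLit≢s l (sym p))
  s-location (clause _ {l} l∈)   (there (here refl)) = l , l∈ , refl
  s-location (clause _ _)        (there (there ()))
  s-location (gadget β _ _)      (here p)           = ⊥-elim (wLit≢s (lit _ (not β)) (sym p))
  s-location (gadget _ _ _)      (there (here ()))
  s-location (gadget _ _ _)      (there (there (here ())))
  s-location (gadget _ _ _)      (there (there (there ())))

  module FromExactCover (exact-cover : ExactCover (matches C1)) where

    S : List (List El)
    S = proj₁ exact-cover

    S⊆M : S ⊆ matches C1
    S⊆M = proj₁ (proj₂ exact-cover)

    exact : ∀ e → occs e S ≡ 1
    exact e = trans (occ-filter e (concat S)) (proj₂ (proj₂ exact-cover) e)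

    open import Data.List.Membership.DecPropositional (ListP.≡-dec (_≟ₑ_ {n} {length C1})) using (_∈?_)

    is-match : ∀ {x} → x ∈ S → IsMatch x
    is-match x∈S = All.lookup all-matches (Sublist.lookup S⊆M x∈S)

    covering : ∀ e → ∃ λ x → x ∈ S × e ∈ x
    covering e = occs≡1-covered (exact e)

    unique : ∀ {e x y} → x ∈ S → y ∈ S → e ∈ x → e ∈ y → x ≡ y
    unique {e} = occs≤1-unique (≤-reflexive (exact e))

    chosen : Fin n → Fin 3 → Bool
    chosen i r = does (gadgetMatch true i r ∈? S)

    gadget-in-cover : ∀ i r → gadgetMatch (chosen i r) i r ∈ S
    gadget-in-cover i r with gadgetMatch true i r ∈? S | covering (a (z i r))
    ... | yes g∈S | _ = g∈S
    ... | no  g∉S | x , x∈S , a∈x with a-location (is-match x∈S) a∈x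
    ...   | true  , refl = ⊥-elim (g∉S x∈S)
    ...   | false , refl = x∈S

    chosen-true : ∀ {i r} → chosen i r ≡ true → gadgetMatch true i r ∈ S
    chosen-true {i} {r} eq = subst (λ β → gadgetMatch β i r ∈ S) eq (gadget-in-cover i r)

    chosen-closed : ∀ i r → chosen i (next r) ≡ true → chosen i r ≡ true
    chosen-closed i r chosen-next with covering (b (z i (next r)))
    ... | x , x∈S , b∈x with b-location (is-match x∈S) b∈x
    ...   | inj₂ refl = dec-true (gadgetMatch true i r ∈? S) x∈S
    ...   | inj₁ refl with () ← unique x∈S (chosen-true chosen-next) (there (here refl)) (there (here refl))

    σ : Var n → Bool
    σ v = uncurry chosen (remQuot {n} 3 v)

    σ-z : ∀ i r → σ (z i r) ≡ chosen i r
    σ-z i r = cong (uncurry chosen) (FinP.remQuot-combine i r)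

    clause-literal : ∀ {j i r β} → clauseMatch j (lit (z i r) β) ∈ S → chosen i r ≡ β
    clause-literal {j} {i} {r} {β} c∈S = agree β (chosen i r) c∈S (gadget-in-cover i r)
      where
      agree : ∀ β γ → clauseMatch j (lit (z i r) β) ∈ S → gadgetMatch γ i r ∈ S → γ ≡ β
      agree true  true  _   _   = refl
      agree false false _   _   = refl
      agree true  false c∈S g∈S = ⊥-elim (clauseMatch≢gadgetMatch (unique c∈S g∈S (here refl) (here refl)))
      agree false true  c∈S g∈S = ⊥-elim (clauseMatch≢gadgetMatch (unique c∈S g∈S (here refl) (here refl)))

    literal-holds : ∀ {j l} → clauseMatch j l ∈ S → Holds σ l
    literal-holds {l = lit v β} c∈S with FinP.combine-surjective {n} {3} v
    ... | i , r , refl = trans (σ-z i r) (clause-literal c∈S)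

    satisfies-C2 : All (Any (Holds σ)) (C2 n)
    satisfies-C2 = Allₚ.concat⁺ (Allₚ.map⁺ (universal (λ i → Allₚ.map⁺ (universal (triple-clause i) (allFin 3))) (allFin n)))
      where
      triple-clause : ∀ i r → Any (Holds σ) (tripleClause i r)
      triple-clause i r with chosen i (next r) in chosen-next
      ... | true  = here (trans (σ-z i r) (chosen-closed i r chosen-next))
      ... | false = there (here (trans (σ-z i (next r)) chosen-next))

    satisfies-C1 : All (Any (Holds σ)) C1
    satisfies-C1 = subst (All _) (ListP.tabulate-lookup C1) (Allₚ.tabulate⁺ clause-satisfied)
      where
      clause-satisfied : ∀ j → Any (Holds σ) (lookup C1 j)
      clause-satisfied j with covering (s j)
      ... | x , x∈S , s∈x with s-location (is-match x∈S) s∈x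
      ...   | l , l∈C , refl = lose l∈C (literal-holds x∈S)

    satisfiable : Satisfiable (C1 ++ C2 n)
    satisfiable = σ , Allₚ.++⁺ satisfies-C1 satisfies-C2

  ∑∑-occ-z : ∀ {κ : Var n → El} → Injective _≡_ _≡_ κ → ∀ (i : Fin n) r →
    ∑[ i′ < n ] ∑[ r′ < 3 ] occ (κ (z i r)) (κ (z i′ r′) ∷ []) ≡ 1
  ∑∑-occ-z {κ} κ-inj i r = begin
    ∑[ i′ < n ] ∑[ r′ < 3 ] occ (κ (z i r)) (κ (z i′ r′) ∷ [])
     
       ≡⟨ ∑-single _ i (λ i′ i′≢i → ∑-occ-∉ λ r′ eq →
           i′≢i (proj₁ (z-injective {i = i′} {i} {r′} {r} (κ-inj eq)))) ⟩
    ∑[ r′ < 3 ] occ (κ (z i r)) (κ (z i r′) ∷ [])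
     
       ≡⟨ ∑-occ-injective (λ {r′} {r″} eq → proj₂ (z-injective {i = i} {i} {r′} {r″} (κ-inj eq))) r ⟩
    1 ∎
    where open ≡-Reasoning

  gadgets : (Fin n → Bool) → List (List El)
  gadgets β = concatMap (λ i → map (gadgetMatch (β i) i) (allFin 3)) (allFin n)

  gadgets-⊆ : ∀ β → gadgets β ⊆
    concatMap (λ i → map (gadgetMatch false i) (allFin 3) ++ map (gadgetMatch true i) (allFin 3)) (allFin n)
  gadgets-⊆ β = concatMap⁺ (λ i → block⊆ (β i) i) (allFin n)
    where
    block⊆ : ∀ γ (i : Fin n) →
      map (gadgetMatch {m = length C1} γ i) (allFin 3) ⊆ map (gadgetMatch false i) (allFin 3) ++ map (gadgetMatch true i) (allFin 3)
    block⊆ false i = Sublistₚ.++⁺ʳ (map (gadgetMatch true i) (allFin 3)) Sublist.⊆-refl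
    block⊆ true  i = Sublistₚ.++⁺ˡ (map (gadgetMatch false i) (allFin 3)) Sublist.⊆-refl

  occs-gadgets : ∀ β e → occs e (gadgets β) ≡ ∑[ i < n ] ∑[ r < 3 ] occ e (gadgetMatch (β i) i r)
  occs-gadgets β e = trans (occs-concatMap-allFin e (λ i → map (gadgetMatch (β i) i) (allFin 3)))
                           (sum-cong-≗ λ i → occs-map-allFin e (gadgetMatch (β i) i))

  occs-gadgets-a : ∀ β u → occs (a u) (gadgets β) ≡ 1
  occs-gadgets-a β u with FinP.combine-surjective {n} {3} u
  ... | i , r , refl = begin
    occs (a (z i r)) (gadgets β)
      ≡⟨ occs-gadgets β _ ⟩
    ∑[ i′ < n ] ∑[ r′ < 3 ] occ (a (z i r)) (gadgetMatch (β i′) i′ r′)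
      ≡⟨ sum-cong-≗ (λ i′ → sum-cong-≗ λ r′ → only-a (β i′) i′ r′) ⟩
    ∑[ i′ < n ] ∑[ r′ < 3 ] occ (a (z i r)) (a (z i′ r′) ∷ [])
      ≡⟨ ∑∑-occ-z a-injective i r ⟩
    1 ∎
    where
    open ≡-Reasoning
    only-a : ∀ γ (i′ : Fin n) r′ → occ (a (z i r)) (gadgetMatch γ i′ r′) ≡ occ (a (z i r)) (a (z i′ r′) ∷ [])
    only-a γ i′ r′ = trans (occ-skip (wLit≢a (lit (z i′ r′) (not γ)))) (occ-∷-∉ λ { (here ()) ; (there ()) })

  occs-gadgets-b : ∀ β u → occs (b u) (gadgets β) ≡ 1
  occs-gadgets-b β u with FinP.combine-surjective {n} {3} u
  ... | i , r , refl = begin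
    occs (b (z i r)) (gadgets β)
      ≡⟨ occs-gadgets β _ ⟩
    ∑[ i′ < n ] ∑[ r′ < 3 ] occ (b (z i r)) (gadgetMatch (β i′) i′ r′)
      ≡⟨ sum-cong-≗ (λ i′ → sum-cong-≗ λ r′ → only-b (β i′) i′ r′) ⟩
    ∑[ i′ < n ] ∑[ r′ < 3 ] occ (b (z i r)) (b (z i′ (rot (β i′) r′)) ∷ [])
      ≡⟨ sum-cong-≗ (λ i′ → ∑-rot (β i′) λ r′ → occ (b (z i r)) (b (z i′ r′) ∷ [])) ⟩
    ∑[ i′ < n ] ∑[ r′ < 3 ] occ (b (z i r)) (b (z i′ r′) ∷ [])
      ≡⟨ ∑∑-occ-z b-injective i r ⟩
    1 ∎
    where
    open ≡-Reasoning
    only-b : ∀ γ (i′ : Fin n) r′ → occ (b (z i r)) (gadgetMatch γ i′ r′) ≡ occ (b (z i r)) (b (z i′ (rot γ r′)) ∷ [])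
    only-b γ i′ r′ = trans (occ-skip (wLit≢b (lit (z i′ r′) (not γ)))) (occ-skip λ ())
    ∑-rot : ∀ γ (f : Fin 3 → ℕ) → ∑[ r < 3 ] f (rot γ r) ≡ ∑[ r < 3 ] f r
    ∑-rot false f = refl
    ∑-rot true  f = ∑-next f

  occs-gadgets-s : ∀ β j → occs (s j) (gadgets β) ≡ 0
  occs-gadgets-s β j = trans (occs-gadgets β _) (∑-zero _ λ i → ∑-zero _ λ r → no-s (β i) i r)
    where
    no-s : ∀ γ (i : Fin n) r → occ (s j) (gadgetMatch γ i r) ≡ 0
    no-s γ i r = occ-∉ λ where
      (here eq)                   → wLit≢s (lit (z i r) (not γ)) (sym eq)
      (there (here ()))
      (there (there (here ())))
      (there (there (there ())))

  occs-gadgets-wLit-≤ : ∀ β l → occs (wLit l) (gadgets β) ≤ 1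
  occs-gadgets-wLit-≤ β l with FinP.combine-surjective {n} {3} (var l)
  ... | i , r , z≡v = begin
    occs (wLit l) (gadgets β)
      ≡⟨ occs-gadgets β _ ⟩
    ∑[ i′ < n ] ∑[ r′ < 3 ] occ (wLit l) (gadgetMatch (β i′) i′ r′)
      ≤⟨ ∑-mono-≤ _ _ (λ i′ → ∑-mono-≤ _ _ λ r′ → below-a (β i′) i′ r′) ⟩
    ∑[ i′ < n ] ∑[ r′ < 3 ] occ (a (z i r)) (a (z i′ r′) ∷ [])
      ≡⟨ ∑∑-occ-z a-injective i r ⟩
    1 ∎
    where
    open ≤-Reasoning
    below-a : ∀ γ (i′ : Fin n) r′ → occ (wLit l) (gadgetMatch γ i′ r′) ≤ occ (a (z i r)) (a (z i′ r′) ∷ [])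
    below-a γ i′ r′ = begin
      occ (wLit l) (gadgetMatch γ i′ r′)
        ≡⟨ only-wLit ⟩
      occ (wLit l) (wLit (lit (z i′ r′) (not γ)) ∷ [])
        ≤⟨ occ-[]-≤ (λ eq → occ-∈ (here (same-variable eq))) ⟩
      occ (a (z i r)) (a (z i′ r′) ∷ []) ∎
      where
      same-variable : wLit (lit (z i′ r′) (not γ)) ≡ wLit l → a (z i r) ≡ a (z i′ r′)
      same-variable eq = cong a (trans z≡v (cong var (wLit-injective {x = l} {y = lit (z i′ r′) (not γ)} (sym eq))))
      only-wLit : occ (wLit l) (gadgetMatch γ i′ r′) ≡ occ (wLit l) (wLit (lit (z i′ r′) (not γ)) ∷ [])
      only-wLit = occ-∷-∉ λ where
        (here eq)         → wLit≢a l eq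
        (there (here eq)) → wLit≢b l eq
        (there (there ()))

  occs-gadgets-wLit-0 : ∀ β {v γ} → (∀ i r → z i r ≡ v → β i ≡ γ) → occs (wLit (lit v γ)) (gadgets β) ≡ 0
  occs-gadgets-wLit-0 β {v} {γ} agrees = trans (occs-gadgets β _) (∑-zero _ λ i → ∑-zero _ λ r → absent i r)
    where
    opposite-sign : ∀ (i : Fin n) r → wLit (lit (z i r) (not (β i))) ≢ wLit (lit v γ)
    opposite-sign i r eq = not-¬ refl (trans (agrees i r (cong var lit≡)) (sym (cong sign lit≡)))
      where
      lit≡ : lit (z i r) (not (β i)) ≡ lit v γ
      lit≡ = wLit-injective eq
    absent : ∀ (i : Fin n) r → occ (wLit (lit v γ)) (gadgetMatch (β i) i r) ≡ 0
    absent i r = occ-∉ λ where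
      (here eq)                   → opposite-sign i r (sym eq)
      (there (here eq))           → wLit≢a (lit v γ) eq
      (there (there (here eq)))   → wLit≢b (lit v γ) eq
      (there (there (there ())))

  clauses : (Fin (length C1) → Literal n) → List (List El)
  clauses ℓ = map (λ j → clauseMatch j (ℓ j)) (allFin (length C1))

  clauses-⊆ : ∀ {ℓ} → (∀ j → ℓ j ∈ lookup C1 j) →
    clauses ℓ ⊆ concatMap (λ j → map (clauseMatch j) (lookup C1 j)) (allFin (length C1))
  clauses-⊆ ℓ∈C = map-⊆-concatMap (λ j → Sublist.from∈ (∈-map⁺ (clauseMatch j) (ℓ∈C j))) (allFin (length C1))

  occs-clauses-s : ∀ ℓ j → occs (s j) (clauses ℓ) ≡ 1
  occs-clauses-s ℓ j = begin
    occs (s j) (clauses ℓ)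
      ≡⟨ occs-map-allFin (s j) (λ j′ → clauseMatch j′ (ℓ j′)) ⟩
    ∑[ j′ < length C1 ] occ (s j) (clauseMatch j′ (ℓ j′))
      ≡⟨ sum-cong-≗ only-s ⟩
    ∑[ j′ < length C1 ] occ (s j) (s j′ ∷ [])
      ≡⟨ ∑-occ-injective s-injective j ⟩
    1 ∎
    where
    open ≡-Reasoning
    only-s : ∀ j′ → occ (s j) (clauseMatch j′ (ℓ j′)) ≡ occ (s j) (s j′ ∷ [])
    only-s j′ = occ-skip (wLit≢s (ℓ j′))

  occs-clauses-a : ∀ ℓ u → occs (a u) (clauses ℓ) ≡ 0
  occs-clauses-a ℓ u = trans (occs-map-allFin (a u) (λ j → clauseMatch j (ℓ j))) (∑-zero _ absent)
    where
    absent : ∀ j → occ (a u) (clauseMatch j (ℓ j)) ≡ 0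
    absent j = occ-∉ λ where
      (here eq)         → wLit≢a (ℓ j) (sym eq)
      (there (here ()))
      (there (there ()))

  occs-clauses-b : ∀ ℓ u → occs (b u) (clauses ℓ) ≡ 0
  occs-clauses-b ℓ u = trans (occs-map-allFin (b u) (λ j → clauseMatch j (ℓ j))) (∑-zero _ absent)
    where
    absent : ∀ j → occ (b u) (clauseMatch j (ℓ j)) ≡ 0
    absent j = occ-∉ λ where
      (here eq)         → wLit≢b (ℓ j) (sym eq)
      (there (here ()))
      (there (there ()))

  occ-clauseMatch-wLit : ∀ (ℓ : Fin (length C1) → Literal n) k j →
    occ (wLit k) (clauseMatch j (ℓ j)) ≡ occ (wLit k) (wLit (ℓ j) ∷ [])
  occ-clauseMatch-wLit ℓ k j = occ-∷-∉ λ { (here eq) → wLit≢s k eq ; (there ()) }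

  occs-clauses-wLit-0 : ∀ ℓ {k} → (∀ j → ℓ j ≢ k) → occs (wLit k) (clauses ℓ) ≡ 0
  occs-clauses-wLit-0 ℓ {k} ℓ≢k = trans (occs-map-allFin (wLit k) (λ j → clauseMatch j (ℓ j)))
    (∑-zero (λ j → occ (wLit k) (clauseMatch j (ℓ j))) λ j →
      trans (occ-clauseMatch-wLit ℓ k j) (occ-≢ (ℓ≢k j ∘ wLit-injective)))

  occs-clauses-wLit-≤ : ∀ {ℓ} → (∀ j → ℓ j ∈ lookup C1 j) →
    (∀ v → length (filter (λ l → var l FinP.≟ v) (concat C1)) ≡ 1) → ∀ k → occs (wLit k) (clauses ℓ) ≤ 1
  occs-clauses-wLit-≤ {ℓ} ℓ∈C once k = begin
    occs (wLit k) (clauses ℓ)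
      ≡⟨ occs-map-allFin (wLit k) (λ j → clauseMatch j (ℓ j)) ⟩
    ∑[ j < length C1 ] occ (wLit k) (clauseMatch j (ℓ j))
      ≤⟨ ∑-mono-≤ _ _ bound ⟩
    ∑[ j < length C1 ] length (filter on-var (lookup C1 j))
      ≡⟨ length-filter-concat-tabulate on-var (lookup C1) ⟨
    length (filter on-var (concat (tabulate (lookup C1))))
      ≡⟨ cong (length ∘ filter on-var ∘ concat) (ListP.tabulate-lookup C1) ⟩
    length (filter on-var (concat C1))
      ≡⟨ once (var k) ⟩
    1 ∎
    where
    open ≤-Reasoning
    on-var : (l : Literal n) → Dec (var l ≡ var k)
    on-var l = var l FinP.≟ var k
    bound : ∀ j → occ (wLit k) (clauseMatch j (ℓ j)) ≤ length (filter on-var (lookup C1 j))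
    bound j = subst (_≤ length (filter on-var (lookup C1 j))) (sym (occ-clauseMatch-wLit ℓ k j))
      (occ-[]-≤ λ eq → length-filter-∈ on-var (ℓ∈C j) (cong var (wLit-injective {x = ℓ j} {y = k} eq)))

  module FromAssignment (wf : WellFormedC1 C1) (σ : Var n → Bool) (sat : Satisfies σ (C1 ++ C2 n)) where

    satisfies-C1 : All (Any (Holds σ)) C1
    satisfies-C1 = proj₁ (Allₚ.++⁻ C1 sat)

    satisfies-C2 : All (Any (Holds σ)) (C2 n)
    satisfies-C2 = proj₂ (Allₚ.++⁻ C1 sat)

    backward : ∀ (i : Fin n) r → σ (z i (next r)) ≡ true → σ (z i r) ≡ true
    backward i r σ-next with All.lookup satisfies-C2 (tripleClause-∈-C2 i r)
    ... | here σ-r               = σ-r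
    ... | there (here σ-next≡false) with () ← trans (sym σ-next) σ-next≡false

    polarity : Fin n → Bool
    polarity i = σ (z i 0F)

    uniform : ∀ (i : Fin n) r → σ (z i r) ≡ polarity i
    uniform i = cycle-constant (σ ∘ z i) (backward i)

    satisfied-literal : ∀ j → ∃ λ l → l ∈ lookup C1 j × Holds σ l
    satisfied-literal j = find (All.lookup satisfies-C1 (∈-lookup j))

    ℓ : Fin (length C1) → Literal n
    ℓ j = proj₁ (satisfied-literal j)

    ℓ∈C1 : ∀ j → ℓ j ∈ lookup C1 j
    ℓ∈C1 j = proj₁ (proj₂ (satisfied-literal j))

    core : List (List El)
    core = clauses ℓ ++ gadgets polarity

    occs-core : ∀ e → occs e core ≡ occs e (clauses ℓ) + occs e (gadgets polarity)
    occs-core e = occs-++ e (clauses ℓ) (gadgets polarity)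

    core-wLit-≤ : ∀ k → occs (wLit k) core ≤ 1
    core-wLit-≤ k@(lit v γ) with σ v Bool.≟ γ
    ... | yes σv≡γ = begin
      occs (wLit k) core
        ≡⟨ occs-core (wLit k) ⟩
      occs (wLit k) (clauses ℓ) + occs (wLit k) (gadgets polarity)
        ≡⟨ cong (occs (wLit k) (clauses ℓ) +_) (occs-gadgets-wLit-0 polarity agrees) ⟩
      occs (wLit k) (clauses ℓ) + 0
        ≡⟨ +-identityʳ _ ⟩
      occs (wLit k) (clauses ℓ)
        ≤⟨ occs-clauses-wLit-≤ ℓ∈C1 (proj₁ wf) k ⟩
      1 ∎
      where
      open ≤-Reasoning
      agrees : ∀ i r → z i r ≡ v → polarity i ≡ γ
      agrees i r refl = trans (sym (uniform i r)) σv≡γ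
    ... | no σv≢γ = begin
      occs (wLit k) core
        ≡⟨ occs-core (wLit k) ⟩
      occs (wLit k) (clauses ℓ) + occs (wLit k) (gadgets polarity)
        ≡⟨ cong (_+ occs (wLit k) (gadgets polarity)) (occs-clauses-wLit-0 ℓ not-chosen) ⟩
      occs (wLit k) (gadgets polarity)
        ≤⟨ occs-gadgets-wLit-≤ polarity k ⟩
      1 ∎
      where
      open ≤-Reasoning
      not-chosen : ∀ j → ℓ j ≢ k
      not-chosen j refl = σv≢γ (proj₂ (proj₂ (satisfied-literal j)))

    cover : List (List El)
    cover = padding core w ++ padding core w̄ ++ core

    cover-⊆ : cover ⊆ matches C1
    cover-⊆ = Sublistₚ.++⁺ (padding-⊆ core w) (Sublistₚ.++⁺ (padding-⊆ core w̄)
      (Sublistₚ.++⁺ (clauses-⊆ ℓ∈C1) (gadgets-⊆ polarity)))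

    occs-cover : ∀ e → occs e cover ≡ occs e (padding core w) + (occs e (padding core w̄) + occs e core)
    occs-cover e = trans (occs-++ e (padding core w) _)
                         (cong (occs e (padding core w) +_) (occs-++ e (padding core w̄) core))

    occs-cover-core : ∀ {e} → (∀ v → w v ≢ e) → (∀ v → w̄ v ≢ e) → occs e cover ≡ occs e core
    occs-cover-core {e} w≢e w̄≢e = trans (occs-cover e)
      (cong₂ _+_ (occs-padding-other core w w≢e) (cong (_+ occs e core) (occs-padding-other core w̄ w̄≢e)))

    exact : ∀ e → occs e cover ≡ 1
    exact (w v) = begin
      occs (w v) cover
        ≡⟨ occs-cover (w v) ⟩
      occs (w v) (padding core w) + (occs (w v) (padding core w̄) + occs (w v) core)
        ≡⟨ cong (λ t → occs (w v) (padding core w) + (t + occs (w v) core)) (occs-padding-other core w̄ (λ _ ())) ⟩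
      occs (w v) (padding core w) + occs (w v) core
        ≡⟨ occs-padding-self core w w-injective v (core-wLit-≤ (lit v true)) ⟩
      1 ∎
      where open ≡-Reasoning
    exact (w̄ v) = begin
      occs (w̄ v) cover
        ≡⟨ occs-cover (w̄ v) ⟩
      occs (w̄ v) (padding core w) + (occs (w̄ v) (padding core w̄) + occs (w̄ v) core)
        ≡⟨ cong (_+ (occs (w̄ v) (padding core w̄) + occs (w̄ v) core)) (occs-padding-other core w (λ _ ())) ⟩
      occs (w̄ v) (padding core w̄) + occs (w̄ v) core
        ≡⟨ occs-padding-self core w̄ w̄-injective v (core-wLit-≤ (lit v false)) ⟩
      1 ∎
      where open ≡-Reasoning
    exact (a u) = trans (occs-cover-core (λ _ ()) (λ _ ()))
      (trans (occs-core (a u)) (cong₂ _+_ (occs-clauses-a ℓ u) (occs-gadgets-a polarity u)))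
    exact (b u) = trans (occs-cover-core (λ _ ()) (λ _ ()))
      (trans (occs-core (b u)) (cong₂ _+_ (occs-clauses-b ℓ u) (occs-gadgets-b polarity u)))
    exact (s j) = trans (occs-cover-core (λ _ ()) (λ _ ()))
      (trans (occs-core (s j)) (cong₂ _+_ (occs-clauses-s ℓ j) (occs-gadgets-s polarity j)))

    exact-cover : ExactCover (matches C1)
    exact-cover = cover , cover-⊆ , λ e → trans (sym (occ-filter e (concat cover))) (exact e)

lemma18 : (n : ℕ) (C1 : CNF n) → WellFormedC1 C1 →
          Satisfiable (C1 ++ C2 n) ⇔ ExactCover (matches C1)
lemma18 n C1 wf = mk⇔ (λ (σ , sat) → FromAssignment.exact-cover wf σ sat) FromExactCover.satisfiable
  where open Reduction C1
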